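{- Let $G$ be a simple connected graph and let $e \ge 1$ be an integer. Suppose $G$ admits a perfect $e$-error-correcting code $D \subseteq V(G)$. Then: (i) if $e = 1$, then for every integer $k \ge 1$ there exists a quasi-perfect $1$-error-correcting code in the Cartesian product $G \square P_{3k}$ and in $G \square C_{3k}$; (ii) if $e \ge 2$, then there exists a quasi-perfect $e$-error-correcting code in $G \square P_3$ and in $G \square C_3$.
   Context: All graphs are simple and connected; $d(x,y)$ is the shortest-path distance. $P_n$ is the path on $n$ vertices and, for $n\ge 3$, $C_n$ is the cycle on $n$ vertices. The Cartesian product $G\square H$ has vertex set $V(G)\times V(H)$, with $(g_1,h_1)$ adjacent to $(g_2,h_2)$ iff either $h_1=h_2$ and $g_1g_2\in E(G)$, or $g_1=g_2$ and $h_1h_2\in E(H)$. A code is a subset $D\subseteq V(G)$. $D$ is $t$-error-correcting if any two distinct codewords are at distance at least $2t+1$. The covering radius of $D$ is the smallest $r$ such that every vertex is at distance at most $r$ from some codeword. $D$ is $t$-perfect (a perfect $t$-error-correcting code) if it is $t$-error-correcting with covering radius $t$, and $t$-quasi-perfect (a quasi-perfect $t$-error-correcting code) if it is $t$-error-correcting with covering radius $t+1$. -}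

module Defs where

open import Data.Nat using (ℕ; zero; suc; _+_; _*_; _<_)
open import Data.Fin using (Fin; toℕ)
open import Data.Product using (Σ; ∃; _×_; _,_)
open import Data.Sum using (_⊎_)
open import Data.Empty using (⊥)
open import Relation.Nullary using (¬_)
open import Relation.Binary.PropositionalEquality using (_≡_)

record Graph : Set₁ where
  field
    V   : Set
    Adj : V → V → Set
open Graph public

Simple : Graph → Set
Simple G = (∀ x y → Adj G x y → Adj G y x) × (∀ x → ¬ Adj G x x)

-- Within G r x y : there is a walk of length at most r from x to y,
-- i.e. d(x,y) ≤ r.
data Within (G : Graph) : ℕ → V G → V G → Set where
  here : ∀ {r x} → Within G r x x
  step : ∀ {r x y z} → Adj G x y → Within G r y z → Within G (suc r) x z

Connected : Graph → Set
Connected G = ∀ x y → ∃ λ r → Within G r x y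

Code : Graph → Set₁
Code G = V G → Set

-- t-error-correcting: distinct codewords at distance ≥ 2t+1, i.e. not ≤ 2t.
ErrorCorrecting : (G : Graph) → ℕ → Code G → Set
ErrorCorrecting G t D =
  ∀ c c' → D c → D c' → ¬ (c ≡ c') → ¬ Within G (t + t) c c'

Covers : (G : Graph) → Code G → ℕ → Set
Covers G D r = ∀ v → ∃ λ c → D c × Within G r c v

CoveringRadius : (G : Graph) → Code G → ℕ → Set
CoveringRadius G D r = Covers G D r × (∀ s → s < r → ¬ Covers G D s)

Perfect : (G : Graph) → ℕ → Code G → Set
Perfect G t D = ErrorCorrecting G t D × CoveringRadius G D t

QuasiPerfect : (G : Graph) → ℕ → Code G → Set
QuasiPerfect G t D = ErrorCorrecting G t D × CoveringRadius G D (suc t)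

PathG : ℕ → Graph
PathG n = record
  { V = Fin n
  ; Adj = λ i j → (toℕ j ≡ suc (toℕ i)) ⊎ (toℕ i ≡ suc (toℕ j)) }

-- Cycle C_n (used for n ≥ 3): path edges plus the edge {0, n-1}.
CycleG : ℕ → Graph
CycleG n = record
  { V = Fin n
  ; Adj = λ i j → (toℕ j ≡ suc (toℕ i)) ⊎ (toℕ i ≡ suc (toℕ j))
                ⊎ (toℕ i ≡ 0 × suc (toℕ j) ≡ n)
                ⊎ (toℕ j ≡ 0 × suc (toℕ i) ≡ n) }

_□_ : Graph → Graph → Graph
G □ H = record
  { V = V G × V H
  ; Adj = λ { (g₁ , h₁) (g₂ , h₂) →
              (h₁ ≡ h₂ × Adj G g₁ g₂) ⊎ (g₁ ≡ g₂ × Adj H h₁ h₂) } }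

-- A product D × S is a quasi-perfect e-code of G □ H as soon as D is a perfect e-code of G
-- and S is an e-code of H that dominates H but misses some vertex h₀: distances add over the
-- two factors, so separation is inherited coordinatewise; every vertex is reached by e steps
-- in G and one in H; and a vertex (g , h₀) needs an H-step, so covering radius e would make
-- D cover G within e − 1. For P_3k and C_3k take S = {i ≡ 1 (mod 3)}; for P_3 and C_3 this is
-- the middle vertex alone, an e-code for every e.
module Submission where

open import Data.Empty using (⊥-elim)
open import Data.Fin using (Fin; toℕ; fromℕ<) renaming (zero to fzero; suc to fsuc)
open import Data.Fin.Properties using (toℕ-injective; toℕ<n; toℕ-fromℕ<)
open import Data.Nat using (ℕ; zero; suc; _+_; _*_; _≤_; _≥_; _<_; z≤n; s≤s)
open import Data.Nat.DivMod using (_%_; %-distribˡ-+; m%n<n; m*n%n≡0)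
open import Data.Nat.Properties
  using (≤-refl; ≤-pred; <-trans; ≤∧≢⇒<; <-irrefl; m≤n+m; m+n≤o⇒m≤o; m+n≤o⇒n≤o; +-suc; *-comm;
         suc-injective; 0≢1+n)
open import Data.Product using (∃; ∃₂; _×_; _,_)
open import Data.Sum using (_⊎_; inj₁; inj₂)
open import Function using (id; _∘_)
open import Relation.Nullary using (¬_)
open import Relation.Binary.PropositionalEquality
  using (_≡_; _≢_; refl; sym; trans; cong; cong₂; subst)
open import Defs

module _ {G : Graph} where

  Within-mono : ∀ {r s x y} → r ≤ s → Within G r x y → Within G s x y
  Within-mono _       here       = here
  Within-mono (s≤s p) (step a w) = step a (Within-mono p w)

  Within-++ : ∀ {r s x y z} → Within G r x y → Within G s y z → Within G (r + s) x z
  Within-++ {r} here       w′ = Within-mono (m≤n+m _ r) w′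
  Within-++     (step a w) w′ = step a (Within-++ w w′)

  Within-zero⇒≡ : ∀ {x y} → Within G 0 x y → x ≡ y
  Within-zero⇒≡ here = refl

  Covers-mono : ∀ {D r s} → r ≤ s → Covers G D r → Covers G D s
  Covers-mono r≤s cover v = let c , c∈D , w = cover v in c , c∈D , Within-mono r≤s w

Within-map : ∀ {G H} (f : V G → V H) → (∀ {x y} → Adj G x y → Adj H (f x) (f y)) →
             ∀ {r x y} → Within G r x y → Within H r (f x) (f y)
Within-map f hom here       = here
Within-map f hom (step a w) = step (hom a) (Within-map f hom w)

Within-□-split : ∀ {G H r g g′ h h′} → Within (G □ H) r (g , h) (g′ , h′) →
                 ∃₂ λ x y → x + y ≤ r × Within G x g g′ × Within H y h h′
Within-□-split here = 0 , 0 , z≤n , here , here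
Within-□-split (step (inj₁ (refl , a)) w) =
  let x , y , x+y≤r , wG , wH = Within-□-split w in suc x , y , s≤s x+y≤r , step a wG , wH
Within-□-split {r = suc r} (step (inj₂ (refl , a)) w) =
  let x , y , x+y≤r , wG , wH = Within-□-split w
  in x , suc y , subst (_≤ suc r) (sym (+-suc x y)) (s≤s x+y≤r) , wG , step a wH

errorCorrecting-pullback : ∀ {G H t S} (f : V G → V H) → (∀ {x y} → f x ≡ f y → x ≡ y) →
                           (∀ {x y} → Adj G x y → Adj H (f x) (f y)) →
                           ErrorCorrecting H t S → ErrorCorrecting G t (S ∘ f)
errorCorrecting-pullback f f-injective hom ec c c′ c∈S c′∈S c≢c′ w =
  ec (f c) (f c′) c∈S c′∈S (c≢c′ ∘ f-injective) (Within-map f hom w)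

errorCorrecting-subsingleton : ∀ {G t S} → (∀ c c′ → S c → S c′ → c ≡ c′) → ErrorCorrecting G t S
errorCorrecting-subsingleton unique c c′ c∈S c′∈S c≢c′ _ = c≢c′ (unique c c′ c∈S c′∈S)

_⊗_ : {A B : Set} → (A → Set) → (B → Set) → A × B → Set
(D ⊗ S) (g , h) = D g × S h

module _ {G H : Graph} {D : Code G} {S : Code H} where

  ⊗-errorCorrecting : ∀ {t} → ErrorCorrecting G t D → ErrorCorrecting H t S →
                      ErrorCorrecting (G □ H) t (D ⊗ S)
  ⊗-errorCorrecting ecD ecS (c , h) (c′ , h′) (c∈D , h∈S) (c′∈D , h′∈S) distinct w =
    let x , y , x+y≤ , wG , wH = Within-□-split w
        c≢c′ : h ≡ h′ → c ≢ c′
        c≢c′ h≡h′ c≡c′ = distinct (cong₂ _,_ c≡c′ h≡h′)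
    in ecS h h′ h∈S h′∈S
         (λ h≡h′ → ecD c c′ c∈D c′∈D (c≢c′ h≡h′) (Within-mono (m+n≤o⇒m≤o x x+y≤) wG))
         (Within-mono (m+n≤o⇒n≤o x x+y≤) wH)

  ⊗-covers : ∀ {r s} → Covers G D r → Covers H S s → Covers (G □ H) (D ⊗ S) (s + r)
  ⊗-covers coverD coverS (g , h) =
    let c , c∈D , wG = coverD g
        c′ , c′∈S , wH = coverS h
    in (c , c′) , (c∈D , c′∈S) ,
       Within-++ (Within-map (c ,_) (λ a → inj₂ (refl , a)) wH)
                 (Within-map (_, h) (λ a → inj₁ (refl , a)) wG)

  ⊗-covers-suc⇒covers : ∀ {r h₀} → ¬ S h₀ → Covers (G □ H) (D ⊗ S) (suc r) → Covers G D r
  ⊗-covers-suc⇒covers {r} {h₀} h₀∉S cover g with cover (g , h₀)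
  ... | (c , h) , (c∈D , h∈S) , w with Within-□-split w
  ... | x , zero  , _   , _  , wH = ⊥-elim (h₀∉S (subst S (Within-zero⇒≡ wH) h∈S))
  ... | x , suc y , x+y≤ , wG , _ =
    c , c∈D , Within-mono (m+n≤o⇒m≤o x (≤-pred (subst (_≤ suc r) (+-suc x y) x+y≤))) wG

  ⊗-quasiPerfect : ∀ {t} → Perfect G (suc t) D → ErrorCorrecting H (suc t) S →
                   Covers H S 1 → (∃ λ h₀ → ¬ S h₀) → QuasiPerfect (G □ H) (suc t) (D ⊗ S)
  ⊗-quasiPerfect {t} (ecD , coverD , minimalD) ecS coverS (_ , h₀∉S) =
    ⊗-errorCorrecting {suc t} ecD ecS ,
    ⊗-covers coverD coverS ,
    λ s s≤t+1 coverₛ →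
      minimalD t ≤-refl (⊗-covers-suc⇒covers h₀∉S (Covers-mono (≤-pred s≤t+1) coverₛ))

suc-%3 : ∀ m {r} → m % 3 ≡ r → suc m % 3 ≡ suc r % 3
suc-%3 m refl = %-distribˡ-+ 1 m 3

%3-cases : ∀ m → m % 3 ≡ 0 ⊎ m % 3 ≡ 1 ⊎ m % 3 ≡ 2
%3-cases m with m % 3 | m%n<n m 3
... | 0                 | _                     = inj₁ refl
... | 1                 | _                     = inj₂ (inj₁ refl)
... | 2                 | _                     = inj₂ (inj₂ refl)
... | suc (suc (suc _)) | s≤s (s≤s (s≤s ()))

%3≡2⇒pred%3≡1 : ∀ m → m % 3 ≡ 2 → ∃ λ p → suc p ≡ m × p % 3 ≡ 1
%3≡2⇒pred%3≡1 (suc p) sp%3≡2 with %3-cases p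
... | inj₁ p%3≡0        with () ← trans (sym (suc-%3 p p%3≡0)) sp%3≡2
... | inj₂ (inj₁ p%3≡1) = p , refl , p%3≡1
... | inj₂ (inj₂ p%3≡2) with () ← trans (sym (suc-%3 p p%3≡2)) sp%3≡2

3*k%3≡0 : ∀ k → 3 * k % 3 ≡ 0
3*k%3≡0 k = trans (cong (_% 3) (*-comm 3 k)) (m*n%n≡0 k 3)

data CyclicSucc (n : ℕ) (i j : Fin n) : Set where
  next : toℕ j ≡ suc (toℕ i) → CyclicSucc n i j
  wrap : toℕ j ≡ 0 → suc (toℕ i) ≡ n → CyclicSucc n i j

cycle-adj⇒cyclicSucc : ∀ {n i j} → Adj (CycleG n) i j → CyclicSucc n i j ⊎ CyclicSucc n j i
cycle-adj⇒cyclicSucc (inj₁ j≡1+i)                        = inj₁ (next j≡1+i)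
cycle-adj⇒cyclicSucc (inj₂ (inj₁ i≡1+j))                 = inj₂ (next i≡1+j)
cycle-adj⇒cyclicSucc (inj₂ (inj₂ (inj₁ (i≡0 , 1+j≡n)))) = inj₂ (wrap i≡0 1+j≡n)
cycle-adj⇒cyclicSucc (inj₂ (inj₂ (inj₂ (j≡0 , 1+i≡n)))) = inj₁ (wrap j≡0 1+i≡n)

cyclicSucc-functional : ∀ {n i j j′} → CyclicSucc n i j → CyclicSucc n i j′ → j ≡ j′
cyclicSucc-functional (next j≡1+i) (next j′≡1+i) = toℕ-injective (trans j≡1+i (sym j′≡1+i))
cyclicSucc-functional (wrap j≡0 _) (wrap j′≡0 _) = toℕ-injective (trans j≡0 (sym j′≡0))
cyclicSucc-functional {j = j} (next j≡1+i) (wrap _ 1+i≡n) =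
  ⊥-elim (<-irrefl (trans j≡1+i 1+i≡n) (toℕ<n j))
cyclicSucc-functional {j′ = j′} (wrap _ 1+i≡n) (next j′≡1+i) =
  ⊥-elim (<-irrefl (trans j′≡1+i 1+i≡n) (toℕ<n j′))

cyclicSucc-injective : ∀ {n i i′ j} → CyclicSucc n i j → CyclicSucc n i′ j → i ≡ i′
cyclicSucc-injective (next j≡1+i) (next j≡1+i′) =
  toℕ-injective (suc-injective (trans (sym j≡1+i) j≡1+i′))
cyclicSucc-injective (wrap _ 1+i≡n) (wrap _ 1+i′≡n) =
  toℕ-injective (suc-injective (trans 1+i≡n (sym 1+i′≡n)))
cyclicSucc-injective (next j≡1+i) (wrap j≡0 _) = ⊥-elim (0≢1+n (trans (sym j≡0) j≡1+i))
cyclicSucc-injective (wrap j≡0 _) (next j≡1+i′) = ⊥-elim (0≢1+n (trans (sym j≡0) j≡1+i′))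

-- Residues advance by one across the wrap-around edge n − 1 → 0 too, because 3 ∣ n.
cyclicSucc-%3 : ∀ {n i j r} → n % 3 ≡ 0 → CyclicSucc n i j → toℕ i % 3 ≡ r → toℕ j % 3 ≡ suc r % 3
cyclicSucc-%3 {i = i} _ (next j≡1+i) i%3≡r = trans (cong (_% 3) j≡1+i) (suc-%3 (toℕ i) i%3≡r)
cyclicSucc-%3 {n} {i} {j} {r} n%3≡0 (wrap j≡0 1+i≡n) i%3≡r = begin
  toℕ j % 3        ≡⟨ cong (_% 3) j≡0 ⟩
  0                ≡⟨ sym n%3≡0 ⟩
  n % 3            ≡⟨ cong (_% 3) (sym 1+i≡n) ⟩
  suc (toℕ i) % 3  ≡⟨ suc-%3 (toℕ i) i%3≡r ⟩
  suc r % 3        ∎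
  where open Relation.Binary.PropositionalEquality.≡-Reasoning

OneMod3 : ∀ {n} → Fin n → Set
OneMod3 i = toℕ i % 3 ≡ 1

-- Residues advance by one along successor steps, and successors and predecessors are unique,
-- so no walk of length at most 2 joins two distinct vertices ≡ 1 (mod 3).
oneMod3-errorCorrecting-cycle : ∀ {n} → n % 3 ≡ 0 → ErrorCorrecting (CycleG n) 1 OneMod3
oneMod3-errorCorrecting-cycle _ c c′ _ _ c≢c′ here = c≢c′ refl
oneMod3-errorCorrecting-cycle n%3≡0 c c′ c≡1 c′≡1 _ (step a here)
  with cycle-adj⇒cyclicSucc a
... | inj₁ c↦c′ with () ← trans (sym c′≡1) (cyclicSucc-%3 n%3≡0 c↦c′ c≡1)
... | inj₂ c′↦c with () ← trans (sym c≡1) (cyclicSucc-%3 n%3≡0 c′↦c c′≡1)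
oneMod3-errorCorrecting-cycle n%3≡0 c c′ c≡1 c′≡1 c≢c′ (step a (step b here))
  with cycle-adj⇒cyclicSucc a | cycle-adj⇒cyclicSucc b
... | inj₁ c↦y | inj₁ y↦c′
    with () ← trans (sym c′≡1) (cyclicSucc-%3 n%3≡0 y↦c′ (cyclicSucc-%3 n%3≡0 c↦y c≡1))
... | inj₂ y↦c | inj₂ c′↦y
    with () ← trans (sym c≡1) (cyclicSucc-%3 n%3≡0 y↦c (cyclicSucc-%3 n%3≡0 c′↦y c′≡1))
... | inj₁ c↦y | inj₂ c′↦y = c≢c′ (cyclicSucc-injective c↦y c′↦y)
... | inj₂ y↦c | inj₁ y↦c′ = c≢c′ (cyclicSucc-functional y↦c y↦c′)

path-adj⇒cycle-adj : ∀ {n} {i j : Fin n} → Adj (PathG n) i j → Adj (CycleG n) i j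
path-adj⇒cycle-adj (inj₁ j≡1+i) = inj₁ j≡1+i
path-adj⇒cycle-adj (inj₂ i≡1+j) = inj₂ (inj₁ i≡1+j)

oneMod3-errorCorrecting-path : ∀ {n} → n % 3 ≡ 0 → ErrorCorrecting (PathG n) 1 OneMod3
oneMod3-errorCorrecting-path n%3≡0 =
  errorCorrecting-pullback {t = 1} id id path-adj⇒cycle-adj (oneMod3-errorCorrecting-cycle n%3≡0)

oneMod3-covers-path : ∀ {n} → n % 3 ≡ 0 → Covers (PathG n) OneMod3 1
oneMod3-covers-path {n} n%3≡0 h with %3-cases (toℕ h)
... | inj₂ (inj₁ h≡1) = h , h≡1 , here
... | inj₁ h≡0 =
  fromℕ< 1+h<n , trans (cong (_% 3) (toℕ-fromℕ< 1+h<n)) (suc-%3 (toℕ h) h≡0) ,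
  step (inj₂ (toℕ-fromℕ< 1+h<n)) here
  where
  1+h≢n : suc (toℕ h) ≢ n
  1+h≢n 1+h≡n with () ← trans (sym (suc-%3 (toℕ h) h≡0)) (trans (cong (_% 3) 1+h≡n) n%3≡0)

  1+h<n : suc (toℕ h) < n
  1+h<n = ≤∧≢⇒< (toℕ<n h) 1+h≢n
... | inj₂ (inj₂ h≡2) with %3≡2⇒pred%3≡1 (toℕ h) h≡2
... | p , 1+p≡h , p≡1 =
  fromℕ< p<n , trans (cong (_% 3) (toℕ-fromℕ< p<n)) p≡1 ,
  step (inj₁ (trans (sym 1+p≡h) (cong suc (sym (toℕ-fromℕ< p<n))))) here
  where
  p<n : p < n
  p<n = <-trans (subst (p <_) 1+p≡h ≤-refl) (toℕ<n h)

oneMod3-covers-cycle : ∀ {n} → n % 3 ≡ 0 → Covers (CycleG n) OneMod3 1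
oneMod3-covers-cycle n%3≡0 h =
  let c , c≡1 , w = oneMod3-covers-path n%3≡0 h
  in c , c≡1 , Within-map id path-adj⇒cycle-adj w

oneMod3-Fin3-unique : (c c′ : Fin 3) → OneMod3 c → OneMod3 c′ → c ≡ c′
oneMod3-Fin3-unique c c′ c≡1 c′≡1 = trans (middle c c≡1) (sym (middle c′ c′≡1))
  where
  middle : (c : Fin 3) → OneMod3 c → c ≡ fsuc fzero
  middle (fsuc fzero)        _  = refl
  middle fzero               ()
  middle (fsuc (fsuc fzero)) ()

theorem1 : (G : Graph) → Simple G → Connected G → (e : ℕ) → e ≥ 1 → (D : Code G) → Perfect G e D →
    ((e ≡ 1 → ∀ (k : ℕ) → k ≥ 1 →
        (∃ λ (D' : Code (G □ PathG (3 * k))) → QuasiPerfect (G □ PathG (3 * k)) 1 D')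
        × (∃ λ (D' : Code (G □ CycleG (3 * k))) → QuasiPerfect (G □ CycleG (3 * k)) 1 D'))
    × (e ≥ 2 →
        (∃ λ (D' : Code (G □ PathG 3)) → QuasiPerfect (G □ PathG 3) e D')
        × (∃ λ (D' : Code (G □ CycleG 3)) → QuasiPerfect (G □ CycleG 3) e D')))
theorem1 G _ _ (suc t) _ D perfect =
  (λ { refl k@(suc _) _ →
       let 3∣3k = 3*k%3≡0 k in
       (D ⊗ OneMod3 , ⊗-quasiPerfect perfect (oneMod3-errorCorrecting-path 3∣3k)
                        (oneMod3-covers-path 3∣3k) (fzero , λ ())) ,
       (D ⊗ OneMod3 , ⊗-quasiPerfect perfect (oneMod3-errorCorrecting-cycle 3∣3k)
                        (oneMod3-covers-cycle 3∣3k) (fzero , λ ())) }) ,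
  λ _ →
    (D ⊗ OneMod3 , ⊗-quasiPerfect perfect (errorCorrecting-subsingleton {t = suc t} oneMod3-Fin3-unique)
                     (oneMod3-covers-path refl) (fzero , λ ())) ,
    (D ⊗ OneMod3 , ⊗-quasiPerfect perfect (errorCorrecting-subsingleton {t = suc t} oneMod3-Fin3-unique)
                     (oneMod3-covers-cycle refl) (fzero , λ ()))
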